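{- For every $k\ge1$, every $n$, and every $k$-increasing input $X\in[0,1]^n$, we have $\mathrm{OPT}_k(X)\le k$. On the other hand, there is an absolute constant $c>0$ such that for every $k\ge1$ and every $n$ there is a $(k+1)$-increasing input $X\in[0,1]^n$ with $\mathrm{OPT}_k(X)\ge c\, n/k^2$.
   Context: A real sequence is $k$-increasing if it avoids the decreasing permutation $(k+1)k\cdots 1$, i.e. it has no (not necessarily contiguous) subsequence of $k+1$ strictly decreasing entries. $k$-server on the line: for requests $X\in[0,1]^n$ and $k$ servers, let $p_i^j\in[0,1]$ be the position of server $j$ after request $i$, with $p_0^j=0$. A solution is valid if for every $i$ some $p_i^j=x_i$; its cost is $\sum_{i}\sum_{j}|p_i^j-p_{i-1}^j|$; $\mathrm{OPT}_k(X)$ is the minimum cost.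
   Formalization: The inputs X of the first claim, and the server positions $p_i^j$ of the schedules bounded below in the second claim, take values in the rationals of $[0,1]$ rather than all of $[0,1]$. -}

module Defs where

open import Data.Nat as ℕ using (ℕ; zero; suc)
open import Data.Integer using (+_)
open import Data.Fin using (Fin; zero; suc; inject₁) renaming (_<_ to _<ᶠ_)
open import Data.Rational using (ℚ; 0ℚ; 1ℚ; _+_; _-_; _*_; ∣_∣; _≤_; _<_; _/_)
open import Data.Product using (Σ; ∃; _×_)
open import Relation.Nullary using (¬_)
open import Relation.Binary.PropositionalEquality using (_≡_)

ℕ→ℚ : ℕ → ℚ
ℕ→ℚ n = + n / 1

sumFin : (m : ℕ) → (Fin m → ℚ) → ℚ
sumFin zero    f = 0ℚ
sumFin (suc m) f = f zero + sumFin m (λ i → f (suc i))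

Input : ℕ → Set
Input n = Fin n → ℚ

InUnit : (n : ℕ) → Input n → Set
InUnit n X = ∀ i → (0ℚ ≤ X i) × (X i ≤ 1ℚ)

HasDecreasing : (m n : ℕ) → Input n → Set
HasDecreasing m n X =
  Σ (Fin m → Fin n) λ f →
    (∀ (a b : Fin m) → a <ᶠ b → f a <ᶠ f b) ×
    (∀ (a b : Fin m) → a <ᶠ b → X (f b) < X (f a))

-- k-increasing: avoids the decreasing permutation (k+1)k...1
KIncreasing : (k n : ℕ) → Input n → Set
KIncreasing k n X = ¬ HasDecreasing (suc k) n X

-- a schedule for k servers: position of server j after request i (i = 0..n),
-- with positions in [0,1] and all servers starting at 0
record Schedule (k n : ℕ) : Set where
  field
    pos     : Fin (suc n) → Fin k → ℚ
    inUnit  : ∀ i j → (0ℚ ≤ pos i j) × (pos i j ≤ 1ℚ)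
    start   : ∀ j → pos zero j ≡ 0ℚ

open Schedule public

-- validity: request i (1-based, i.e. index suc i) is served by some server
Valid : (k n : ℕ) → Input n → Schedule k n → Set
Valid k n X s = ∀ (i : Fin n) → ∃ λ (j : Fin k) → pos s (suc i) j ≡ X i

cost : (k n : ℕ) → Schedule k n → ℚ
cost k n s = sumFin n (λ i → sumFin k (λ j → ∣ pos s (suc i) j - pos s (inject₁ i) j ∣))

-- OPT_k(X) ≤ B  (OPT is a minimum, attained): some valid schedule costs ≤ B
OPT≤ : (k n : ℕ) → Input n → ℚ → Set
OPT≤ k n X B = Σ (Schedule k n) λ s → Valid k n X s × (cost k n s ≤ B)

OPT≥ : (k n : ℕ) → Input n → ℚ → Set
OPT≥ k n X B = ∀ (s : Schedule k n) → Valid k n X s → B ≤ cost k n s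

-- n / k² as a rational (only used for k ≥ 1; the k = 0 clause is an arbitrary junk value)
_/sq_ : ℕ → ℕ → ℚ
n /sq zero    = 0ℚ
n /sq (suc m) = + n / (suc m ℕ.* suc m)

{-# OPTIONS --safe #-}

-- Call the height of a request the number of steps of a longest strictly
-- decreasing chain of requests starting at it. In a k-increasing input all heights are
-- below k, and a later request with a smaller value has a smaller height, so the requests
-- of one height form a nondecreasing subsequence. If server h serves exactly the requests
-- of height h, every server only moves rightwards inside [0,1]; it travels at most 1, and
-- the total cost is at most k.
--
-- For K servers take the sawtooth input requesting (t mod (K+1))/K at time t,
-- time 0 being the common starting point 0. It takes only K+1 values, so it is
-- (K+1)-increasing. Each window of K+1 consecutive times starting at a multiple of K+1
-- requests all K+1 values, so by pigeonhole some server serves two of them and moves at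
-- least 1/K inside the window. The ⌊n/(K+1)⌋ disjoint windows (or, when n ≤ K, the first
-- request alone) give a cost of at least q/K with n ≤ 4qK, that is at least n/(4K²).

module Submission where

open import Defs
open import Data.Nat as ℕ using (ℕ; suc)
open import Data.Rational using (ℚ; 0ℚ; 1ℚ; _<_; _≤_; _*_; _+_; _-_; -_; ∣_∣; _/_; toℚᵘ)
open import Data.Product using (Σ; _×_; _,_; proj₁; proj₂; map₂)

open import Data.Bool using (if_then_else_)
open import Data.Fin as Fin using (Fin; zero; suc; toℕ; inject₁)
import Data.Fin.Properties as Fin
open import Data.Integer as ℤ using (+_)
import Data.Integer.Properties as ℤ
open import Data.Integer.Tactic.RingSolver using (solve-∀)
open import Data.Nat.DivMod using (_mod_; _%_; [m+kn]%n≡m%n; m<n⇒m%n≡m; m/n*n≤m; m≡m%n+[m/n]*n; m%n<n; m≥n⇒m/n>0)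
import Data.Nat.Properties as ℕ
import Data.Nat.Tactic.RingSolver as ℕ-Solver
open import Data.Rational.Properties
open import Algebra.Properties.CommutativeMonoid.Sum +-0-commutativeMonoid
  using (sum; sum-syntax; sum-cong-≗; sum-init-last; sum-remove; sum-replicate-zero; ∑-comm)
open import Data.Rational.Solver using (module +-*-Solver)
import Data.Rational.Unnormalised as ℚᵘ
import Data.Rational.Unnormalised.Properties as ℚᵘ
open import Data.Sum using (_⊎_; inj₁; inj₂)
open import Data.Vec.Functional using (removeAt)
open import Function using (_∘_)
open import Relation.Binary.PropositionalEquality
open import Relation.Nullary using (Dec; does; yes; no)
open import Relation.Nullary.Decidable using (dec-true)
open import Relation.Nullary.Negation using (contradiction)

infix 8 _÷_

_÷_ : ℕ → (d : ℕ) → .{{ℕ.NonZero d}} → ℚ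
a ÷ d = + a / d

toℚᵘ-÷ : ∀ a d .{{_ : ℕ.NonZero d}} → toℚᵘ (a ÷ d) ℚᵘ.≃ (+ a) ℚᵘ./ d
toℚᵘ-÷ a (suc d) = toℚᵘ-fromℚᵘ (ℚᵘ.mkℚᵘ (+ a) d)

÷-mono-≤ : ∀ {a b d e} .{{_ : ℕ.NonZero d}} .{{_ : ℕ.NonZero e}} →
           a ℕ.* e ℕ.≤ b ℕ.* d → a ÷ d ≤ b ÷ e
÷-mono-≤ {a} {b} {suc d} {suc e} ae≤bd = toℚᵘ-cancel-≤
  (ℚᵘ.≤-respˡ-≃ (ℚᵘ.≃-sym (toℚᵘ-÷ a (suc d))) (ℚᵘ.≤-respʳ-≃ (ℚᵘ.≃-sym (toℚᵘ-÷ b (suc e)))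
    (ℚᵘ.*≤* (subst₂ ℤ._≤_ (ℤ.pos-* a (suc e)) (ℤ.pos-* b (suc d)) (ℤ.+≤+ ae≤bd)))))

÷-nonNeg : ∀ a d .{{_ : ℕ.NonZero d}} → 0ℚ ≤ a ÷ d
÷-nonNeg a d = subst (_≤ a ÷ d) (0/n≡0 d) (÷-mono-≤ {0} {a} {d} {d} ℕ.z≤n)

÷≤1 : ∀ {a d} .{{_ : ℕ.NonZero d}} → a ℕ.≤ d → a ÷ d ≤ 1ℚ
÷≤1 {a} {d} a≤d = ÷-mono-≤ {a} {1} {d} {1} (subst₂ ℕ._≤_ (sym (ℕ.*-identityʳ a)) (sym (ℕ.*-identityˡ d)) a≤d)

÷-+ : ∀ a b d .{{_ : ℕ.NonZero d}} → a ÷ d + b ÷ d ≡ (a ℕ.+ b) ÷ d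
÷-+ a b d = toℚᵘ-injective (begin
  toℚᵘ (a ÷ d + b ÷ d)              ≈⟨ toℚᵘ-homo-+ (a ÷ d) (b ÷ d) ⟩
  toℚᵘ (a ÷ d) ℚᵘ.+ toℚᵘ (b ÷ d)    ≈⟨ ℚᵘ.+-cong (toℚᵘ-÷ a d) (toℚᵘ-÷ b d) ⟩
  (+ a) ℚᵘ./ d ℚᵘ.+ (+ b) ℚᵘ./ d    ≈⟨ common-denominator d ⟩
  (+ (a ℕ.+ b)) ℚᵘ./ d              ≈⟨ ℚᵘ.≃-sym (toℚᵘ-÷ (a ℕ.+ b) d) ⟩
  toℚᵘ ((a ℕ.+ b) ÷ d)              ∎)
  where
  open ℚᵘ.≃-Reasoning
  distrib : ∀ x y z → (x ℤ.* z ℤ.+ y ℤ.* z) ℤ.* z ≡ (x ℤ.+ y) ℤ.* (z ℤ.* z)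
  distrib = solve-∀
  common-denominator : ∀ d .{{_ : ℕ.NonZero d}} → (+ a) ℚᵘ./ d ℚᵘ.+ (+ b) ℚᵘ./ d ℚᵘ.≃ (+ (a ℕ.+ b)) ℚᵘ./ d
  common-denominator (suc d) = ℚᵘ.*≡* (trans (distrib (+ a) (+ b) (+ suc d))
    (cong (ℤ._* (+ suc d ℤ.* + suc d)) (sym (ℤ.pos-+ a b))))

÷-* : ∀ a b d e .{{_ : ℕ.NonZero d}} .{{_ : ℕ.NonZero e}} →
      a ÷ d * b ÷ e ≡ ((a ℕ.* b) ÷ (d ℕ.* e)) {{ℕ.m*n≢0 d e}}
÷-* a b d e = toℚᵘ-injective (begin
  toℚᵘ (a ÷ d * b ÷ e)                             ≈⟨ toℚᵘ-homo-* (a ÷ d) (b ÷ e) ⟩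
  toℚᵘ (a ÷ d) ℚᵘ.* toℚᵘ (b ÷ e)                   ≈⟨ ℚᵘ.*-cong (toℚᵘ-÷ a d) (toℚᵘ-÷ b e) ⟩
  ((+ a) ℚᵘ./ d) ℚᵘ.* ((+ b) ℚᵘ./ e)               ≈⟨ componentwise d e ⟩
  ((+ (a ℕ.* b)) ℚᵘ./ (d ℕ.* e)) {{ℕ.m*n≢0 d e}}   ≈⟨ ℚᵘ.≃-sym (toℚᵘ-÷ (a ℕ.* b) (d ℕ.* e) {{ℕ.m*n≢0 d e}}) ⟩
  toℚᵘ (((a ℕ.* b) ÷ (d ℕ.* e)) {{ℕ.m*n≢0 d e}})   ∎)
  where
  open ℚᵘ.≃-Reasoning
  componentwise : ∀ d e .{{_ : ℕ.NonZero d}} .{{_ : ℕ.NonZero e}} →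
    ((+ a) ℚᵘ./ d) ℚᵘ.* ((+ b) ℚᵘ./ e) ℚᵘ.≃ ((+ (a ℕ.* b)) ℚᵘ./ (d ℕ.* e)) {{ℕ.m*n≢0 d e}}
  componentwise (suc d) (suc e) = ℚᵘ.*≡* (cong₂ ℤ._*_ (sym (ℤ.pos-* a b)) (ℤ.pos-* (suc d) (suc e)))

p≤∣p∣ : ∀ p → p ≤ ∣ p ∣
p≤∣p∣ p with ≤-total 0ℚ p
... | inj₁ 0≤p = ≤-reflexive (sym (0≤p⇒∣p∣≡p 0≤p))
... | inj₂ p≤0 = ≤-trans p≤0 (0≤∣p∣ p)

p≤q⇒0≤q-p : ∀ {p q} → p ≤ q → 0ℚ ≤ q - p
p≤q⇒0≤q-p {p} {q} p≤q = subst (_≤ q - p) (+-inverseʳ p) (+-monoˡ-≤ (- p) p≤q)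

p+r≤q⇒r≤∣q-p∣ : ∀ {p q r} → p + r ≤ q → r ≤ ∣ q - p ∣
p+r≤q⇒r≤∣q-p∣ {p} {q} {r} p+r≤q = ≤-trans r≤q-p (p≤∣p∣ (q - p))
  where
  open +-*-Solver
  cancel : ∀ p r → p + r - p ≡ r
  cancel = solve 2 (λ p r → p :+ r :- p := r) refl
  r≤q-p : r ≤ q - p
  r≤q-p = subst (_≤ q - p) (cancel p r) (+-monoˡ-≤ (- p) p+r≤q)

∣p-r∣≤∣p-q∣+∣q-r∣ : ∀ p q r → ∣ p - r ∣ ≤ ∣ p - q ∣ + ∣ q - r ∣
∣p-r∣≤∣p-q∣+∣q-r∣ p q r =
  subst (λ x → ∣ x ∣ ≤ ∣ p - q ∣ + ∣ q - r ∣) (split p q r) (∣p+q∣≤∣p∣+∣q∣ (p - q) (q - r))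
  where
  open +-*-Solver
  split : ∀ p q r → (p - q) + (q - r) ≡ p - r
  split = solve 3 (λ p q r → (p :- q) :+ (q :- r) := p :- r) refl

sumFin≡sum : ∀ n (f : Fin n → ℚ) → sumFin n f ≡ sum f
sumFin≡sum ℕ.zero  f = refl
sumFin≡sum (suc n) f = cong (_+_ (f zero)) (sumFin≡sum n (f ∘ suc))

∑-mono-≤ : ∀ {n} {f g : Fin n → ℚ} → (∀ i → f i ≤ g i) → sum f ≤ sum g
∑-mono-≤ {ℕ.zero} f≤g = ≤-refl
∑-mono-≤ {suc n}  f≤g = +-mono-≤ (f≤g zero) (∑-mono-≤ (f≤g ∘ suc))

∑-nonNeg : ∀ {n} {f : Fin n → ℚ} → (∀ i → 0ℚ ≤ f i) → 0ℚ ≤ sum f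
∑-nonNeg {n} {f} 0≤f = subst (_≤ sum f) (sum-replicate-zero n) (∑-mono-≤ 0≤f)

term≤∑ : ∀ {n} {f : Fin n → ℚ} → (∀ i → 0ℚ ≤ f i) → ∀ i → f i ≤ sum f
term≤∑ {suc n} {f} 0≤f i = begin
  f i                        ≡⟨ +-identityʳ (f i) ⟨
  f i + 0ℚ                   ≤⟨ +-monoʳ-≤ (f i) (∑-nonNeg (0≤f ∘ Fin.punchIn i)) ⟩
  f i + sum (removeAt f i)   ≡⟨ sum-remove f ⟨
  sum f                      ∎
  where open ≤-Reasoning

∑-telescope : ∀ n (f : ℕ → ℚ) → ∑[ i < n ] (f (suc (toℕ i)) - f (toℕ i)) ≡ f n - f 0
∑-telescope ℕ.zero  f = sym (+-inverseʳ (f 0))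
∑-telescope (suc n) f = begin
  (f 1 - f 0) + ∑[ i < n ] (f (suc (suc (toℕ i))) - f (suc (toℕ i)))
    ≡⟨ cong (_+_ (f 1 - f 0)) (∑-telescope n (f ∘ suc)) ⟩
  (f 1 - f 0) + (f (suc n) - f 1)
    ≡⟨ shift (f 0) (f 1) (f (suc n)) ⟩
  f (suc n) - f 0 ∎
  where
  open ≡-Reasoning
  open +-*-Solver
  shift : ∀ a b c → (b - a) + (c - b) ≡ c - a
  shift = solve 3 (λ a b c → (b :- a) :+ (c :- b) := c :- a) refl

∑1≡n : ∀ n → ∑[ i < n ] 1ℚ ≡ n ÷ 1
∑1≡n ℕ.zero  = refl
∑1≡n (suc n) = trans (cong (_+_ 1ℚ) (∑1≡n n)) (÷-+ 1 n 1)

module _ {k : ℕ} (P : ℕ → Fin k → ℚ) where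

  stepCost : ℕ → ℚ
  stepCost t = ∑[ j < k ] ∣ P (suc t) j - P t j ∣

  costUpTo : ℕ → ℚ
  costUpTo T = ∑[ t < T ] stepCost (toℕ t)

  stepCost-nonNeg : ∀ t → 0ℚ ≤ stepCost t
  stepCost-nonNeg t = ∑-nonNeg {k} (λ j → 0≤∣p∣ _)

  costUpTo-suc : ∀ T → costUpTo (suc T) ≡ costUpTo T + stepCost T
  costUpTo-suc T = trans (sum-init-last {T} (stepCost ∘ toℕ))
    (cong₂ _+_ (sum-cong-≗ {T} (cong stepCost ∘ Fin.toℕ-inject₁)) (cong stepCost (Fin.toℕ-fromℕ T)))

  costUpTo-mono : ∀ {a b} → a ℕ.≤′ b → costUpTo a ≤ costUpTo b
  costUpTo-mono (ℕ.≤′-reflexive refl) = ≤-refl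
  costUpTo-mono {a} (ℕ.≤′-step {b} a≤b) = begin
    costUpTo a                ≡⟨ +-identityʳ (costUpTo a) ⟨
    costUpTo a + 0ℚ           ≤⟨ +-mono-≤ (costUpTo-mono a≤b) (stepCost-nonNeg b) ⟩
    costUpTo b + stepCost b   ≡⟨ costUpTo-suc b ⟨
    costUpTo (suc b)          ∎
    where open ≤-Reasoning

  displacement≤costUpTo : ∀ j {a b} → a ℕ.≤′ b → costUpTo a + ∣ P b j - P a j ∣ ≤ costUpTo b
  displacement≤costUpTo j {a} (ℕ.≤′-reflexive refl) = ≤-reflexive (begin
    costUpTo a + ∣ P a j - P a j ∣   ≡⟨ cong (λ x → costUpTo a + ∣ x ∣) (+-inverseʳ (P a j)) ⟩
    costUpTo a + 0ℚ                  ≡⟨ +-identityʳ (costUpTo a) ⟩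
    costUpTo a                       ∎)
    where open ≡-Reasoning
  displacement≤costUpTo j {a} (ℕ.≤′-step {b} a≤b) = begin
    costUpTo a + ∣ P (suc b) j - P a j ∣
      ≤⟨ +-monoʳ-≤ (costUpTo a) (∣p-r∣≤∣p-q∣+∣q-r∣ (P (suc b) j) (P b j) (P a j)) ⟩
    costUpTo a + (∣ P (suc b) j - P b j ∣ + ∣ P b j - P a j ∣)
      ≡⟨ regroup (costUpTo a) _ _ ⟩
    (costUpTo a + ∣ P b j - P a j ∣) + ∣ P (suc b) j - P b j ∣
      ≤⟨ +-mono-≤ (displacement≤costUpTo j a≤b) (term≤∑ (λ j → 0≤∣p∣ _) j) ⟩
    costUpTo b + stepCost b
      ≡⟨ costUpTo-suc b ⟨
    costUpTo (suc b) ∎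
    where
    open ≤-Reasoning
    open +-*-Solver
    regroup : ∀ x y z → x + (y + z) ≡ (x + z) + y
    regroup = solve 3 (λ x y z → x :+ (y :+ z) := (x :+ z) :+ y) refl

  costUpTo≡∑displacement : (∀ t j → P t j ≤ P (suc t) j) → ∀ T → costUpTo T ≡ ∑[ j < k ] (P T j - P 0 j)
  costUpTo≡∑displacement P-mono T = begin
    ∑[ t < T ] ∑[ j < k ] ∣ P (suc (toℕ t)) j - P (toℕ t) j ∣
      ≡⟨ sum-cong-≗ {T} (λ t → sum-cong-≗ {k} (λ j → 0≤p⇒∣p∣≡p (p≤q⇒0≤q-p (P-mono (toℕ t) j)))) ⟩
    ∑[ t < T ] ∑[ j < k ] (P (suc (toℕ t)) j - P (toℕ t) j)
      ≡⟨ ∑-comm {T} {k} (λ t j → P (suc (toℕ t)) j - P (toℕ t) j) ⟩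
    ∑[ j < k ] ∑[ t < T ] (P (suc (toℕ t)) j - P (toℕ t) j)
      ≡⟨ sum-cong-≗ {k} (λ j → ∑-telescope T (λ t → P t j)) ⟩
    ∑[ j < k ] (P T j - P 0 j) ∎
    where open ≡-Reasoning

cost≡costUpTo : ∀ {k n} (s : Schedule k n) (P : ℕ → Fin k → ℚ) →
                (∀ i j → pos s i j ≡ P (toℕ i) j) → cost k n s ≡ costUpTo P n
cost≡costUpTo {k} {n} s P pos≡P = trans (sumFin≡sum n _) (sum-cong-≗ step≡stepCost)
  where
  step≡stepCost : ∀ i → sumFin k (λ j → ∣ pos s (suc i) j - pos s (inject₁ i) j ∣) ≡ stepCost P (toℕ i)
  step≡stepCost i = trans (sumFin≡sum k _) (sum-cong-≗ λ j → cong₂ (λ x y → ∣ x - y ∣)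
    (pos≡P (suc i) j) (trans (pos≡P (inject₁ i) j) (cong (λ t → P t j) (Fin.toℕ-inject₁ i))))

-- The value 0ℚ after time n is junk.
trajectory : ∀ {k n} → Schedule k n → ℕ → Fin k → ℚ
trajectory {n = n} s t j with t ℕ.<? suc n
... | yes t≤n = pos s (Fin.fromℕ< t≤n) j
... | no _    = 0ℚ

trajectory-toℕ : ∀ {k n} (s : Schedule k n) i j → pos s i j ≡ trajectory s (toℕ i) j
trajectory-toℕ {n = n} s i j with toℕ i ℕ.<? suc n
... | yes i≤n = cong (λ i → pos s i j) (sym (Fin.fromℕ<-toℕ i i≤n))
... | no i≰n  = contradiction (Fin.toℕ<n i) i≰n

-- Upper bound

⨆ : ∀ {n} → (Fin n → ℕ) → ℕ
⨆ {ℕ.zero} g = 0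
⨆ {suc n}  g = g zero ℕ.⊔ ⨆ (g ∘ suc)

≤-⨆ : ∀ {n} (g : Fin n → ℕ) j → g j ℕ.≤ ⨆ g
≤-⨆ g zero    = ℕ.m≤m⊔n _ _
≤-⨆ g (suc j) = ℕ.≤-trans (≤-⨆ (g ∘ suc) j) (ℕ.m≤n⊔m (g zero) _)

⨆-sel : ∀ {n} (g : Fin n → ℕ) → ⨆ g ≡ 0 ⊎ Σ (Fin n) λ j → ⨆ g ≡ g j
⨆-sel {ℕ.zero} g = inj₁ refl
⨆-sel {suc n}  g with ℕ.⊔-sel (g zero) (⨆ (g ∘ suc)) | ⨆-sel (g ∘ suc)
... | inj₁ ⨆≡g0 | _               = inj₂ (zero , ⨆≡g0)
... | inj₂ ⨆≡⨆  | inj₁ ⨆≡0        = inj₁ (trans ⨆≡⨆ ⨆≡0)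
... | inj₂ ⨆≡⨆  | inj₂ (j , ⨆≡gj) = inj₂ (suc j , trans ⨆≡⨆ ⨆≡gj)

data DecreasingChain {n} (X : Input n) : ℕ → Fin n → Set where
  [_]  : ∀ i → DecreasingChain X 0 i
  step : ∀ {m i j} → i Fin.< j → X j < X i → DecreasingChain X m j → DecreasingChain X (suc m) i

DecreasingChain-tail : ∀ {n} {X : Input (suc n)} {m j} →
                       DecreasingChain (X ∘ suc) m j → DecreasingChain X m (suc j)
DecreasingChain-tail [ j ]              = [ suc j ]
DecreasingChain-tail (step i<j Xj<Xi c) = step (ℕ.s≤s i<j) Xj<Xi (DecreasingChain-tail c)

DecreasingChain⇒HasDecreasing : ∀ {n} {X : Input n} {m i} → DecreasingChain X m i → HasDecreasing (suc m) n X
DecreasingChain⇒HasDecreasing c = let f , _ , inc , dec = from c in f , inc , dec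
  where
  from : ∀ {n} {X : Input n} {m i} → DecreasingChain X m i →
         Σ (Fin (suc m) → Fin n) λ f → f zero ≡ i ×
           (∀ a b → a Fin.< b → f a Fin.< f b) × (∀ a b → a Fin.< b → X (f b) < X (f a))
  from [ i ] = (λ _ → i) , refl , (λ { zero zero () }) , (λ { zero zero () })
  from {X = X} {i = i} (step i<j Xj<Xi c) with from c
  ... | f , refl , inc , dec = g , refl , g-inc , g-dec
    where
    g : Fin _ → Fin _
    g zero    = i
    g (suc a) = f a
    f0≤f : ∀ b → toℕ (f zero) ℕ.≤ toℕ (f b)
    f0≤f zero    = ℕ.≤-refl
    f0≤f (suc b) = ℕ.<⇒≤ (inc zero (suc b) (ℕ.s≤s ℕ.z≤n))
    Xf≤Xf0 : ∀ b → X (f b) ≤ X (f zero)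
    Xf≤Xf0 zero    = ≤-refl
    Xf≤Xf0 (suc b) = <⇒≤ (dec zero (suc b) (ℕ.s≤s ℕ.z≤n))
    g-inc : ∀ a b → a Fin.< b → g a Fin.< g b
    g-inc zero    (suc b) _           = ℕ.<-≤-trans i<j (f0≤f b)
    g-inc (suc a) (suc b) (ℕ.s≤s a<b) = inc a b a<b
    g-dec : ∀ a b → a Fin.< b → X (g b) < X (g a)
    g-dec zero    (suc b) _           = ≤-<-trans (Xf≤Xf0 b) Xj<Xi
    g-dec (suc a) (suc b) (ℕ.s≤s a<b) = dec a b a<b

HasDecreasing-≤ : ∀ {m m′ n} {X : Input n} → m ℕ.≤ m′ → HasDecreasing m′ n X → HasDecreasing m n X
HasDecreasing-≤ m≤m′ (f , inc , dec) =
  f ∘ inj , (λ a b a<b → inc (inj a) (inj b) (inj-< a<b)) , (λ a b a<b → dec (inj a) (inj b) (inj-< a<b))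
  where
  inj : Fin _ → Fin _
  inj a = Fin.inject≤ a m≤m′
  inj-< : ∀ {a b} → a Fin.< b → inj a Fin.< inj b
  inj-< {a} {b} = subst₂ ℕ._<_ (sym (Fin.toℕ-inject≤ a m≤m′)) (sym (Fin.toℕ-inject≤ b m≤m′))

-- height X i is the number of steps of a longest strictly decreasing chain of X starting
-- at i; heightVia X j is the height of the first request when its chain continues at suc j.
mutual
  height : ∀ {n} → Input n → Fin n → ℕ
  height {suc n} X zero    = ⨆ (heightVia X)
  height {suc n} X (suc i) = height (X ∘ suc) i

  heightVia : ∀ {n} → Input (suc n) → Fin n → ℕ
  heightVia X j = if does (X (suc j) <? X zero) then suc (height (X ∘ suc) j) else 0

height-chain : ∀ {n} (X : Input n) i → DecreasingChain X (height X i) i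
height-chain {suc n} X (suc i) = DecreasingChain-tail (height-chain (X ∘ suc) i)
height-chain {suc n} X zero with ⨆-sel (heightVia X)
... | inj₁ h≡0        = subst (λ h → DecreasingChain X h zero) (sym h≡0) [ zero ]
... | inj₂ (j , h≡hj) = via (X (suc j) <? X zero) h≡hj
  where
  via : (d : Dec (X (suc j) < X zero)) →
        height X zero ≡ (if does d then suc (height (X ∘ suc) j) else 0) → DecreasingChain X (height X zero) zero
  via (yes Xj<X0) h≡ = subst (λ h → DecreasingChain X h zero) (sym h≡)
                         (step (ℕ.s≤s ℕ.z≤n) Xj<X0 (DecreasingChain-tail (height-chain (X ∘ suc) j)))
  via (no _)      h≡ = subst (λ h → DecreasingChain X h zero) (sym h≡) [ zero ]

height-antitone : ∀ {n} (X : Input n) {i i′} → i Fin.< i′ → X i′ < X i → height X i′ ℕ.< height X i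
height-antitone {suc n} X {zero} {suc j} _ Xj<X0 =
  subst (ℕ._≤ height X zero)
    (cong (if_then suc (height (X ∘ suc) j) else 0) (dec-true (X (suc j) <? X zero) Xj<X0))
    (≤-⨆ (heightVia X) j)
height-antitone {suc n} X {suc i} {suc i′} (ℕ.s≤s i<i′) Xi′<Xi = height-antitone (X ∘ suc) i<i′ Xi′<Xi

height<k : ∀ {k n} {X : Input n} → KIncreasing k n X → ∀ i → height X i ℕ.< k
height<k {k} {X = X} k-inc i with k ℕ.≤? height X i
... | no k≰h  = ℕ.≰⇒> k≰h
... | yes k≤h = contradiction
                  (HasDecreasing-≤ {X = X} (ℕ.s≤s k≤h) (DecreasingChain⇒HasDecreasing (height-chain X i)))
                  k-inc

ClassesNondecreasing : ∀ {k n} → Input n → (Fin n → Fin k) → Set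
ClassesNondecreasing X σ = ∀ {i i′} → i Fin.< i′ → σ i ≡ σ i′ → X i ≤ X i′

KIncreasing⇒nondecreasingClasses : ∀ {k n} {X : Input n} → KIncreasing k n X →
                                    Σ (Fin n → Fin k) (ClassesNondecreasing X)
KIncreasing⇒nondecreasingClasses {X = X} k-inc = σ , σ-nondecreasing
  where
  σ : Fin _ → Fin _
  σ i = Fin.fromℕ< (height<k k-inc i)
  σ-nondecreasing : ClassesNondecreasing X σ
  σ-nondecreasing {i} {i′} i<i′ σi≡σi′ = ≮⇒≥ λ Xi′<Xi →
    ℕ.<-irrefl (sym (Fin.fromℕ<-injective _ _ (height<k k-inc i) (height<k k-inc i′) σi≡σi′))
      (height-antitone X i<i′ Xi′<Xi)

module FollowClasses {k n} (X : Input n) (X∈[0,1] : InUnit n X)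
                     (σ : Fin n → Fin k) (σ-nondecreasing : ClassesNondecreasing X σ) where

  position : ℕ → Fin k → ℚ
  position ℕ.zero  j = 0ℚ
  position (suc t) j with t ℕ.<? n
  ... | no _    = position t j
  ... | yes t<n with σ (Fin.fromℕ< t<n) Fin.≟ j
  ...   | yes _ = X (Fin.fromℕ< t<n)
  ...   | no _  = position t j

  position-suc : ∀ t j → position (suc t) j ≡ position t j ⊎
                         Σ (Fin n) λ i → toℕ i ≡ t × σ i ≡ j × position (suc t) j ≡ X i
  position-suc t j with t ℕ.<? n
  ... | no _    = inj₁ refl
  ... | yes t<n with σ (Fin.fromℕ< t<n) Fin.≟ j
  ...   | yes σt≡j = inj₂ (Fin.fromℕ< t<n , Fin.toℕ-fromℕ< t<n , σt≡j , refl)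
  ...   | no _     = inj₁ refl

  position-serves : ∀ i → position (suc (toℕ i)) (σ i) ≡ X i
  position-serves i with toℕ i ℕ.<? n
  ... | no i≮n  = contradiction (Fin.toℕ<n i) i≮n
  ... | yes i<n with σ (Fin.fromℕ< i<n) Fin.≟ σ i
  ...   | yes _    = cong X (Fin.fromℕ<-toℕ i i<n)
  ...   | no σi≢σi = contradiction (cong σ (Fin.fromℕ<-toℕ i i<n)) σi≢σi

  position∈[0,1] : ∀ t j → (0ℚ ≤ position t j) × (position t j ≤ 1ℚ)
  position∈[0,1] ℕ.zero  j = ≤-refl , nonNegative⁻¹ 1ℚ
  position∈[0,1] (suc t) j with position-suc t j
  ... | inj₁ stays               = subst (λ x → (0ℚ ≤ x) × (x ≤ 1ℚ)) (sym stays) (position∈[0,1] t j)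
  ... | inj₂ (i , _ , _ , moves) = subst (λ x → (0ℚ ≤ x) × (x ≤ 1ℚ)) (sym moves) (X∈[0,1] i)

  position-origin-or-earlier : ∀ t j → position t j ≡ 0ℚ ⊎
                               Σ (Fin n) λ i → toℕ i ℕ.< t × σ i ≡ j × position t j ≡ X i
  position-origin-or-earlier ℕ.zero  j = inj₁ refl
  position-origin-or-earlier (suc t) j with position-suc t j
  ... | inj₂ (i , refl , σi≡j , moves) = inj₂ (i , ℕ.≤-refl , σi≡j , moves)
  ... | inj₁ stays with position-origin-or-earlier t j
  ...   | inj₁ at0                     = inj₁ (trans stays at0)
  ...   | inj₂ (i , i<t , σi≡j , at-i) = inj₂ (i , ℕ.m≤n⇒m≤1+n i<t , σi≡j , trans stays at-i)

  position-mono : ∀ t j → position t j ≤ position (suc t) j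
  position-mono t j with position-suc t j
  ... | inj₁ stays = ≤-reflexive (sym stays)
  ... | inj₂ (i′ , refl , σi′≡j , moves) with position-origin-or-earlier t j
  ...   | inj₁ at0                      = subst₂ _≤_ (sym at0) (sym moves) (proj₁ (X∈[0,1] i′))
  ...   | inj₂ (i , i<i′ , σi≡j , at-i) =
          subst₂ _≤_ (sym at-i) (sym moves) (σ-nondecreasing i<i′ (trans σi≡j (sym σi′≡j)))

  schedule : Schedule k n
  schedule = record { pos = position ∘ toℕ ; inUnit = position∈[0,1] ∘ toℕ ; start = λ _ → refl }

  valid : Valid k n X schedule
  valid i = σ i , position-serves i

  cost≤k : cost k n schedule ≤ ℕ→ℚ k
  cost≤k = begin
    cost k n schedule                ≡⟨ cost≡costUpTo schedule position (λ _ _ → refl) ⟩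
    costUpTo position n              ≡⟨ costUpTo≡∑displacement position position-mono n ⟩
    ∑[ j < k ] (position n j - 0ℚ)   ≤⟨ ∑-mono-≤ {k} (λ j → subst (_≤ 1ℚ) (sym (+-identityʳ (position n j)))
                                                                 (proj₂ (position∈[0,1] n j))) ⟩
    ∑[ j < k ] 1ℚ                    ≡⟨ ∑1≡n k ⟩
    ℕ→ℚ k                            ∎
    where open ≤-Reasoning

OPT≤k : ∀ {k n} (X : Input n) → InUnit n X → KIncreasing k n X → OPT≤ k n X (ℕ→ℚ k)
OPT≤k X X∈[0,1] k-inc = schedule , valid , cost≤k
  where
  open FollowClasses X X∈[0,1] (proj₁ (KIncreasing⇒nondecreasingClasses k-inc))
                               (proj₂ (KIncreasing⇒nondecreasingClasses k-inc))

-- Lower bound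

fewValues⇒KIncreasing : ∀ {m n} (X : Input n) (c : Fin n → Fin m) →
                        (∀ {i i′} → c i ≡ c i′ → X i ≡ X i′) → KIncreasing m n X
fewValues⇒KIncreasing {m} X c c-determines-X (f , _ , dec) with Fin.pigeonhole (ℕ.n<1+n m) (c ∘ f)
... | a , b , a<b , ca≡cb = <-irrefl (c-determines-X (sym ca≡cb)) (dec a b a<b)

window-cost : ∀ {K} (P : ℕ → Fin K → ℚ) a {δ} (v : Fin (suc K) → ℚ) →
              (∀ x → Σ (Fin K) λ j → P (a ℕ.+ toℕ x) j ≡ v x) →
              (∀ {x y} → x Fin.< y → δ ≤ ∣ v y - v x ∣) →
              costUpTo P a + δ ≤ costUpTo P (a ℕ.+ K)
window-cost {K} P a {δ} v served separated with Fin.pigeonhole (ℕ.n<1+n K) (proj₁ ∘ served)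
... | x , y , x<y , jx≡jy = begin
  costUpTo P a + δ
    ≤⟨ +-mono-≤ (costUpTo-mono P (ℕ.m≤′m+n a (toℕ x))) (separated x<y) ⟩
  costUpTo P (a ℕ.+ toℕ x) + ∣ v y - v x ∣
    ≡⟨ cong (λ d → costUpTo P (a ℕ.+ toℕ x) + ∣ d ∣) (cong₂ _-_ (sym Py) (sym Px)) ⟩
  costUpTo P (a ℕ.+ toℕ x) + ∣ P (a ℕ.+ toℕ y) j - P (a ℕ.+ toℕ x) j ∣
    ≤⟨ displacement≤costUpTo P j (ℕ.≤⇒≤′ (ℕ.+-monoʳ-≤ a (ℕ.<⇒≤ x<y))) ⟩
  costUpTo P (a ℕ.+ toℕ y)
    ≤⟨ costUpTo-mono P (ℕ.≤⇒≤′ (ℕ.+-monoʳ-≤ a (ℕ.≤-pred (Fin.toℕ<n y)))) ⟩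
  costUpTo P (a ℕ.+ K) ∎
  where
  open ≤-Reasoning
  j = proj₁ (served x)
  Px : P (a ℕ.+ toℕ x) j ≡ v x
  Px = proj₂ (served x)
  Py : P (a ℕ.+ toℕ y) j ≡ v y
  Py = subst (λ j → P (a ℕ.+ toℕ y) j ≡ v y) (sym jx≡jy) (proj₂ (served y))

[1+q][1+K]≤4qK : ∀ {q K} → 1 ℕ.≤ q → 1 ℕ.≤ K → suc q ℕ.* suc K ℕ.≤ 4 ℕ.* q ℕ.* K
[1+q][1+K]≤4qK {q} {K} 1≤q 1≤K = begin
  suc q ℕ.* suc K           ≤⟨ ℕ.*-mono-≤ (ℕ.+-monoˡ-≤ q 1≤q) (ℕ.+-monoˡ-≤ K 1≤K) ⟩
  (q ℕ.+ q) ℕ.* (K ℕ.+ K)   ≡⟨ double² q K ⟩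
  4 ℕ.* q ℕ.* K             ∎
  where
  open ℕ.≤-Reasoning
  double² : ∀ q K → (q ℕ.+ q) ℕ.* (K ℕ.+ K) ≡ 4 ℕ.* q ℕ.* K
  double² = ℕ-Solver.solve-∀

module Sawtooth (K : ℕ) .{{_ : ℕ.NonZero K}} where

  wave : ℕ → ℚ
  wave t = toℕ (t mod suc K) ÷ K

  -- Request i is issued at time i + 1; time 0 stands for the starting point 0 = wave 0.
  input : ∀ n → Input n
  input n i = wave (suc (toℕ i))

  wave∈[0,1] : ∀ t → (0ℚ ≤ wave t) × (wave t ≤ 1ℚ)
  wave∈[0,1] t = ÷-nonNeg (toℕ (t mod suc K)) K , ÷≤1 (ℕ.≤-pred (Fin.toℕ<n (t mod suc K)))

  input∈[0,1] : ∀ n → InUnit n (input n)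
  input∈[0,1] n i = wave∈[0,1] (suc (toℕ i))

  input-increasing : ∀ n → KIncreasing (suc K) n (input n)
  input-increasing n = fewValues⇒KIncreasing (input n) (λ i → suc (toℕ i) mod suc K) (cong (λ r → toℕ r ÷ K))

  wave-period : ∀ q x → wave (q ℕ.* suc K ℕ.+ toℕ x) ≡ toℕ x ÷ K
  wave-period q x = cong (_÷ K) (begin
    toℕ ((q ℕ.* suc K ℕ.+ toℕ x) mod suc K)   ≡⟨ Fin.toℕ-fromℕ< _ ⟩
    (q ℕ.* suc K ℕ.+ toℕ x) % suc K           ≡⟨ cong (_% suc K) (ℕ.+-comm (q ℕ.* suc K) (toℕ x)) ⟩
    (toℕ x ℕ.+ q ℕ.* suc K) % suc K           ≡⟨ [m+kn]%n≡m%n (toℕ x) q (suc K) ⟩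
    toℕ x % suc K                             ≡⟨ m<n⇒m%n≡m (Fin.toℕ<n x) ⟩
    toℕ x                                     ∎)
    where open ≡-Reasoning

  module _ {n} (s : Schedule K n) (valid : Valid K n (input n) s) where

    private
      P : ℕ → Fin K → ℚ
      P = trajectory s

    served : ∀ t → t ℕ.≤ n → Σ (Fin K) λ j → P t j ≡ wave t
    served ℕ.zero _ = j₀ , trans (sym (trajectory-toℕ s zero j₀)) (trans (start s j₀) (sym (0/n≡0 K)))
      where
      j₀ : Fin K
      j₀ = Fin.fromℕ< (ℕ.>-nonZero⁻¹ K)
    served (suc t) t<n with valid (Fin.fromℕ< t<n)
    ... | j , serves = j , subst (λ u → P (suc u) j ≡ wave (suc u)) (Fin.toℕ-fromℕ< t<n)
                                 (trans (sym (trajectory-toℕ s (suc (Fin.fromℕ< t<n)) j)) serves)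

    windows-cost : ∀ q → q ℕ.* suc K ℕ.≤ n → q ÷ K ≤ costUpTo P (q ℕ.* suc K)
    windows-cost ℕ.zero  _        = ≤-reflexive (0/n≡0 K)
    windows-cost (suc q) [1+q]N≤n = begin
      suc q ÷ K                          ≡⟨ trans (÷-+ q 1 K) (cong (_÷ K) (ℕ.+-comm q 1)) ⟨
      q ÷ K + 1 ÷ K                      ≤⟨ +-monoˡ-≤ (1 ÷ K) (windows-cost q (ℕ.≤-trans (ℕ.m≤n+m _ (suc K)) [1+q]N≤n)) ⟩
      costUpTo P (q ℕ.* suc K) + 1 ÷ K   ≤⟨ window-cost P (q ℕ.* suc K) (λ x → toℕ x ÷ K) served-window separated ⟩
      costUpTo P (q ℕ.* suc K ℕ.+ K)     ≤⟨ costUpTo-mono P (ℕ.≤′-step (ℕ.≤′-reflexive (ℕ.+-comm (q ℕ.* suc K) K))) ⟩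
      costUpTo P (suc q ℕ.* suc K)       ∎
      where
      open ≤-Reasoning
      end≤n : q ℕ.* suc K ℕ.+ K ℕ.≤ n
      end≤n = ℕ.≤-trans (ℕ.≤-reflexive (ℕ.+-comm (q ℕ.* suc K) K)) (ℕ.≤-trans (ℕ.n≤1+n _) [1+q]N≤n)
      served-window : ∀ x → Σ (Fin K) λ j → P (q ℕ.* suc K ℕ.+ toℕ x) j ≡ toℕ x ÷ K
      served-window x with served (q ℕ.* suc K ℕ.+ toℕ x)
                                  (ℕ.≤-trans (ℕ.+-monoʳ-≤ (q ℕ.* suc K) (ℕ.≤-pred (Fin.toℕ<n x))) end≤n)
      ... | j , serves = j , trans serves (wave-period q x)
      separated : ∀ {x y : Fin (suc K)} → x Fin.< y → 1 ÷ K ≤ ∣ toℕ y ÷ K - toℕ x ÷ K ∣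
      separated {x} {y} x<y = p+r≤q⇒r≤∣q-p∣ (subst (_≤ toℕ y ÷ K) (sym (÷-+ (toℕ x) 1 K))
        (÷-mono-≤ {toℕ x ℕ.+ 1} {toℕ y} (ℕ.*-monoˡ-≤ K (subst (ℕ._≤ toℕ y) (ℕ.+-comm 1 (toℕ x)) x<y))))

    first-request-cost : 1 ℕ.≤ n → 1 ÷ K ≤ costUpTo P n
    first-request-cost 1≤n with served 1 1≤n
    ... | j , serves = begin
      1 ÷ K                              ≤⟨ p+r≤q⇒r≤∣q-p∣ {P 0 j} {P 1 j} (≤-reflexive
                                              (trans (cong (_+ 1 ÷ K) P0≡0) (trans (+-identityˡ (1 ÷ K)) (sym P1≡1/K)))) ⟩
      ∣ P 1 j - P 0 j ∣                  ≡⟨ +-identityˡ _ ⟨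
      costUpTo P 0 + ∣ P 1 j - P 0 j ∣   ≤⟨ displacement≤costUpTo P j {0} (ℕ.≤′-step (ℕ.≤′-reflexive refl)) ⟩
      costUpTo P 1                       ≤⟨ costUpTo-mono P (ℕ.≤⇒≤′ 1≤n) ⟩
      costUpTo P n                       ∎
      where
      open ≤-Reasoning hiding (start)
      P0≡0 : P 0 j ≡ 0ℚ
      P0≡0 = trans (sym (trajectory-toℕ s zero j)) (start s j)
      P1≡1/K : P 1 j ≡ 1 ÷ K
      P1≡1/K = trans serves (cong (_÷ K) (trans (Fin.toℕ-fromℕ< _) (m<n⇒m%n≡m (ℕ.s≤s (ℕ.>-nonZero⁻¹ K)))))

    costUpTo-lowerBound : Σ ℕ λ q → n ℕ.≤ 4 ℕ.* q ℕ.* K × q ÷ K ≤ costUpTo P n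
    costUpTo-lowerBound with 1 ℕ.≤? n | n ℕ.≤? K
    ... | no 1≰n  | _       = 0 , ℕ.≤-reflexive (ℕ.n<1⇒n≡0 (ℕ.≰⇒> 1≰n)) ,
                              ≤-trans (windows-cost 0 ℕ.z≤n) (costUpTo-mono P {0} {n} (ℕ.≤⇒≤′ ℕ.z≤n))
    ... | yes 1≤n | yes n≤K = 1 , ℕ.≤-trans n≤K (ℕ.m≤n*m K 4) , first-request-cost 1≤n
    ... | yes _   | no n≰K  = q , n≤4qK , ≤-trans (windows-cost q qN≤n) (costUpTo-mono P (ℕ.≤⇒≤′ qN≤n))
      where
      q = n ℕ./ suc K
      qN≤n : q ℕ.* suc K ℕ.≤ n
      qN≤n = m/n*n≤m n (suc K)
      n<[1+q]N : n ℕ.< suc q ℕ.* suc K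
      n<[1+q]N = subst (ℕ._< suc q ℕ.* suc K) (sym (m≡m%n+[m/n]*n n (suc K)))
                   (ℕ.+-monoˡ-< (q ℕ.* suc K) (m%n<n n (suc K)))
      n≤4qK : n ℕ.≤ 4 ℕ.* q ℕ.* K
      n≤4qK = ℕ.≤-trans (ℕ.<⇒≤ n<[1+q]N) ([1+q][1+K]≤4qK (m≥n⇒m/n>0 (ℕ.≰⇒> n≰K)) (ℕ.>-nonZero⁻¹ K))

    cost-lowerBound : Σ ℕ λ q → n ℕ.≤ 4 ℕ.* q ℕ.* K × q ÷ K ≤ cost K n s
    cost-lowerBound = map₂ (map₂ (subst (_ ≤_) (sym (cost≡costUpTo s P (trajectory-toℕ s))))) costUpTo-lowerBound

quarter-bound : ∀ {n q m} → n ℕ.≤ 4 ℕ.* q ℕ.* suc m → 1 ÷ 4 * (n /sq suc m) ≤ q ÷ suc m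
quarter-bound {n} {q} {m} n≤4qK = subst (_≤ q ÷ K) (sym (÷-* 1 n 4 (K ℕ.* K)))
  (÷-mono-≤ {1 ℕ.* n} {q} (subst₂ ℕ._≤_ (cong (ℕ._* K) (sym (ℕ.*-identityˡ n))) (regroup q K) (ℕ.*-monoˡ-≤ K n≤4qK)))
  where
  K = suc m
  regroup : ∀ q K → 4 ℕ.* q ℕ.* K ℕ.* K ≡ q ℕ.* (4 ℕ.* (K ℕ.* K))
  regroup = ℕ-Solver.solve-∀

mainTheorem8 :
    ((k n : ℕ) → 1 ℕ.≤ k → (X : Input n) → InUnit n X → KIncreasing k n X →
      OPT≤ k n X (ℕ→ℚ k))
    ×
    (Σ ℚ λ c → (0ℚ < c) ×
      ((k n : ℕ) → 1 ℕ.≤ k →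
        Σ (Input n) λ X → InUnit n X × KIncreasing (suc k) n X ×
          OPT≥ k n X (c * (n /sq k))))
mainTheorem8 = (λ k n _ → OPT≤k) , 1 ÷ 4 , positive⁻¹ (1 ÷ 4) , sawtooth
  where
  sawtooth : (k n : ℕ) → 1 ℕ.≤ k →
             Σ (Input n) λ X → InUnit n X × KIncreasing (suc k) n X × OPT≥ k n X (1 ÷ 4 * (n /sq k))
  sawtooth (suc m) n _ = input n , input∈[0,1] n , input-increasing n , λ s valid →
    let q , n≤4qK , q/K≤cost = cost-lowerBound s valid in ≤-trans (quarter-bound {n} {q} n≤4qK) q/K≤cost
    where open Sawtooth (suc m)
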